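{- Let $\mathbf{A}$ be a square-increasing IRL and let $a\in A$ with $f\leqslant a$. Then $a^3=a^2$. In particular, $f^3=f^2$.
   Context: An involutive (commutative) residuated lattice (IRL) is an algebra $\langle A;\cdot,\wedge,\vee,\neg,e\rangle$ such that $\langle A;\cdot,e\rangle$ is a commutative monoid, $\langle A;\wedge,\vee\rangle$ is a lattice with order $\leqslant$, $\neg\neg x=x$, and $x\cdot y\leqslant z\iff \neg z\cdot y\leqslant\neg x$. Write $f:=\neg e$, $x^2:=x\cdot x$, $x^3:=x^2\cdot x$. It is square-increasing if $x\leqslant x^2$ for all $x$. -}

module Defs where

open import Level using (Level; suc; _⊔_)
open import Relation.Binary.PropositionalEquality using (_≡_; setoid)
open import Algebra.Core using (Op₁; Op₂)
open import Algebra.Structures using (IsCommutativeMonoid)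
open import Algebra.Lattice.Structures using (IsLattice)
open import Data.Product using (_×_)

record IRL (a : Level) : Set (suc a) where
  infixl 7 _·_
  infixr 6 _∧_
  infixr 5 _∨_
  infix 8 ¬_
  infix 4 _≤_
  field
    Carrier : Set a
    _·_     : Op₂ Carrier
    _∧_     : Op₂ Carrier
    _∨_     : Op₂ Carrier
    ¬_      : Op₁ Carrier
    e       : Carrier
    isCommutativeMonoid : IsCommutativeMonoid _≡_ _·_ e
    isLattice           : IsLattice _≡_ _∨_ _∧_

  _≤_ : Carrier → Carrier → Set a
  x ≤ y = x ∧ y ≡ x

  field
    ¬¬-involutive : ∀ x → ¬ (¬ x) ≡ x
    residuation   : ∀ x y z → (x · y ≤ z → (¬ z) · y ≤ ¬ x)
                              × ((¬ z) · y ≤ ¬ x → x · y ≤ z)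

  f : Carrier
  f = ¬ e

  _² : Carrier → Carrier
  x ² = x · x

  _³ : Carrier → Carrier
  x ³ = (x ²) · x

  SquareIncreasing : Set a
  SquareIncreasing = ∀ x → x ≤ (x ²)

module Submission where

-- Residuation with x := e says that, in any IRL,
--   x ≤ y  iff  ¬ y · x ≤ f,
-- and from it one gets that ¬ is antitone and · is monotone.  Put
-- u := ¬ (a ²).  Since a ² · u ≤ f, the hypothesis f ≤ a yields
-- f · (a · u) ≤ a ² · u ≤ f, i.e. a · u ≤ e.  If moreover u ≤ u ²
-- (square-increasing), then
--   a ³ · u ≤ a ³ · (u · u) = (a ² · u) · (a · u) ≤ f · e = f,
-- so a ³ ≤ a ²; the converse a ² ≤ a ³ is square-increasing
-- multiplied by a.

open import Defs
open import Level using (Level)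
open import Relation.Binary.PropositionalEquality
  using (_≡_; refl; sym; trans; cong; isEquivalence)
open import Data.Product using (_×_; _,_; proj₁; proj₂)
open import Algebra.Bundles using (CommutativeMonoid)
open import Algebra.Lattice.Bundles using (Lattice)
open import Relation.Binary.Bundles using (Poset)
import Algebra.Lattice.Properties.Lattice as LatticeProperties
import Algebra.Properties.CommutativeSemigroup as CommSemigroupProperties
import Relation.Binary.Reasoning.PartialOrder as PosetReasoning

module IRLProperties {ℓ : Level} (A : IRL ℓ) where
  open IRL A

  monoid : CommutativeMonoid ℓ ℓ
  monoid = record { isCommutativeMonoid = isCommutativeMonoid }

  lattice : Lattice ℓ ℓ
  lattice = record { isLattice = isLattice }

  open CommutativeMonoid monoid using (assoc; comm; identityˡ; identityʳ)
  open CommSemigroupProperties (CommutativeMonoid.commutativeSemigroup monoid)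
    using (interchange)
  open Lattice lattice using (∧-comm; ∧-assoc)
  open LatticeProperties lattice using (∧-idem)

  poset : Poset ℓ ℓ ℓ
  poset = record
    { Carrier = Carrier
    ; _≈_ = _≡_
    ; _≤_ = _≤_
    ; isPartialOrder = record
      { isPreorder = record
        { isEquivalence = isEquivalence
        ; reflexive = λ { {x} refl → ∧-idem x }
        ; trans = meet-order-trans
        }
      ; antisym = λ {x} {y} x≤y y≤x → trans (sym x≤y) (trans (∧-comm x y) y≤x)
      }
    }
    where
    meet-order-trans : ∀ {x y z} → x ≤ y → y ≤ z → x ≤ z
    meet-order-trans {x} {y} {z} x≤y y≤z =
      trans (cong (_∧ z) (sym x≤y)) (trans (∧-assoc x y z) (trans (cong (x ∧_) y≤z) x≤y))

  open Poset poset public using () renaming (refl to ≤-refl; antisym to ≤-antisym)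
  open PosetReasoning poset

  ≤⇒¬·≤f : ∀ {x y} → x ≤ y → ¬ y · x ≤ f
  ≤⇒¬·≤f {x} {y} x≤y = proj₁ (residuation e x y) (begin e · x ≡⟨ identityˡ x ⟩ x ≤⟨ x≤y ⟩ y ∎)

  ¬·≤f⇒≤ : ∀ {x y} → ¬ y · x ≤ f → x ≤ y
  ¬·≤f⇒≤ {x} {y} ¬y·x≤f = begin
    x      ≡⟨ identityˡ x ⟨
    e · x  ≤⟨ proj₂ (residuation e x y) ¬y·x≤f ⟩
    y      ∎

  ·¬≤f : ∀ x → x · ¬ x ≤ f
  ·¬≤f x = begin x · ¬ x ≡⟨ comm x (¬ x) ⟩ ¬ x · x ≤⟨ ≤⇒¬·≤f ≤-refl ⟩ f ∎

  ¬-antitone : ∀ {x y} → x ≤ y → ¬ y ≤ ¬ x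
  ¬-antitone {x} {y} x≤y = ¬·≤f⇒≤ (begin
    ¬ ¬ x · ¬ y  ≡⟨ cong (_· ¬ y) (¬¬-involutive x) ⟩
    x · ¬ y      ≡⟨ comm x (¬ y) ⟩
    ¬ y · x      ≤⟨ ≤⇒¬·≤f x≤y ⟩
    f            ∎)

  ·-monoˡ : ∀ {x y} z → x ≤ y → x · z ≤ y · z
  ·-monoˡ {x} {y} z x≤y = proj₂ (residuation x z (y · z)) (begin
    ¬ (y · z) · z  ≤⟨ proj₁ (residuation y z (y · z)) ≤-refl ⟩
    ¬ y            ≤⟨ ¬-antitone x≤y ⟩
    ¬ x            ∎)

  ·-monoʳ : ∀ {x y} z → x ≤ y → z · x ≤ z · y
  ·-monoʳ {x} {y} z x≤y = begin
    z · x  ≡⟨ comm z x ⟩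
    x · z  ≤⟨ ·-monoˡ z x≤y ⟩
    y · z  ≡⟨ comm y z ⟩
    z · y  ∎

  ·¬²≤e : ∀ {a} → f ≤ a → a · ¬ (a ²) ≤ e
  ·¬²≤e {a} f≤a = ¬·≤f⇒≤ (begin
    f · (a · ¬ (a ²))  ≤⟨ ·-monoˡ _ f≤a ⟩
    a · (a · ¬ (a ²))  ≡⟨ assoc a a (¬ (a ²)) ⟨
    a ² · ¬ (a ²)      ≤⟨ ·¬≤f (a ²) ⟩
    f                  ∎)

  cube≤square : SquareIncreasing → ∀ {a} → f ≤ a → a ³ ≤ a ²
  cube≤square sq {a} f≤a = ¬·≤f⇒≤ (begin
    ¬ (a ²) · a ³                    ≡⟨ comm (¬ (a ²)) (a ³) ⟩
    a ³ · u                          ≤⟨ ·-monoʳ (a ³) (sq u) ⟩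
    (a ² · a) · (u · u)              ≡⟨ interchange (a ²) a u u ⟩
    (a ² · u) · (a · u)              ≤⟨ ·-monoˡ (a · u) (·¬≤f (a ²)) ⟩
    f · (a · u)                      ≤⟨ ·-monoʳ f (·¬²≤e f≤a) ⟩
    f · e                            ≡⟨ identityʳ f ⟩
    f                                ∎)
    where
    u : Carrier
    u = ¬ (a ²)

  square≤cube : SquareIncreasing → ∀ a → a ² ≤ a ³
  square≤cube sq a = ·-monoˡ a (sq a)

lemma3p1 : {ℓ : Level} (A : IRL ℓ) → IRL.SquareIncreasing A →
    ((a : IRL.Carrier A) → IRL._≤_ A (IRL.f A) a → IRL._³ A a ≡ IRL._² A a)
    × (IRL._³ A (IRL.f A) ≡ IRL._² A (IRL.f A))
lemma3p1 A sq = cube≡square , cube≡square f ≤-refl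
  where
  open IRL A using (f)
  open IRLProperties A using (≤-refl; ≤-antisym; cube≤square; square≤cube)

  cube≡square : ∀ a → IRL._≤_ A f a → IRL._³ A a ≡ IRL._² A a
  cube≡square a f≤a = ≤-antisym (cube≤square sq f≤a) (square≤cube sq a)
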